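{- For every integer $k\ge 1$, $3\le \chi_{la}(kC(8,2))\le 4$.
   Context: For a graph $G=(V,E)$ with $|E|=m$ and no isolated vertices, a local antimagic labeling is a bijection $f:E\to\{1,\dots,m\}$ such that $f^+(u)\ne f^+(v)$ for every edge $uv$, where $f^+(x)=\sum f(e)$ over all edges $e$ incident to $x$. The local antimagic chromatic number $\chi_{la}(G)$ is the minimum, over all local antimagic labelings $f$ of $G$, of the number of distinct values taken by $f^+$ (also for disconnected graphs). $kG$ is the disjoint union of $k$ copies of $G$. Let $C_8^*$ be the graph consisting of an 8-cycle $u_1u_2\cdots u_8u_1$ together with an additional vertex $x$ adjacent to $u_2$ and $u_6$. $C(8,2)$ is obtained from $C_8^*$ by merging $x$ and $u_8$ into a single vertex $z$ (so $C(8,2)$ is the 8-cycle $u_1\cdots u_8u_1$ with the extra edges $u_8u_2$ and $u_8u_6$, and $z=u_8$ has degree 4). -}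

module Defs where

open import Data.Nat using (ℕ; zero; suc; _+_; _*_; _≤_)
open import Data.Nat.Properties using (_≟_)
open import Data.Fin using (Fin; toℕ; #_; remQuot; combine)
import Data.Fin.Properties as FinP
open import Data.List using (List; map; allFin; deduplicate; length)
open import Data.Nat.ListAction using (sum)
open import Data.Vec using (Vec; lookup; []; _∷_)
open import Data.Product using (_×_; _,_; proj₁; proj₂; ∃)
open import Data.Sum using (_⊎_)
open import Relation.Binary.PropositionalEquality using (_≡_; _≢_)
open import Relation.Nullary using (yes; no)
open import Function.Bundles using (_⤖_; Bijection)

record Graph : Set where
  field
    n    : ℕ
    m    : ℕ
    ends : Fin m → Fin n × Fin n
open Graph public

-- An edge labeling: a bijection E → {1,…,m}, encoded as a bijection
-- Fin m ⤖ Fin m; edge e gets label  toℕ (f e) + 1.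
Labeling : Graph → Set
Labeling G = Fin (m G) ⤖ Fin (m G)

label : (G : Graph) → Labeling G → Fin (m G) → ℕ
label G f e = suc (toℕ (Bijection.to f e))

incid : (G : Graph) → Fin (n G) → Fin (m G) → ℕ → ℕ
incid G v e x with FinP._≟_ (proj₁ (ends G e)) v | FinP._≟_ (proj₂ (ends G e)) v
... | yes _ | _     = x
... | no _  | yes _ = x
... | no _  | no _  = 0

vsum : (G : Graph) → Labeling G → Fin (n G) → ℕ
vsum G f v = sum (map (λ e → incid G v e (label G f e)) (allFin (m G)))

IsLocalAntimagic : (G : Graph) → Labeling G → Set
IsLocalAntimagic G f =
  ∀ (e : Fin (m G)) → vsum G f (proj₁ (ends G e)) ≢ vsum G f (proj₂ (ends G e))

numValues : (G : Graph) → Labeling G → ℕ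
numValues G f = length (deduplicate _≟_ (map (vsum G f) (allFin (n G))))

χla≤ : Graph → ℕ → Set
χla≤ G c = ∃ λ (f : Labeling G) → IsLocalAntimagic G f × numValues G f ≤ c

≤χla : ℕ → Graph → Set
≤χla c G = ∀ (f : Labeling G) → IsLocalAntimagic G f → c ≤ numValues G f

-- C(8,2): vertices u1..u8 ↦ 0..7; cycle edges u_i u_{i+1}, u8u1,
-- plus u8u2 and u8u6.
C82edges : Vec (Fin 8 × Fin 8) 10
C82edges = (# 0 , # 1) ∷ (# 1 , # 2) ∷ (# 2 , # 3) ∷ (# 3 , # 4) ∷ (# 4 , # 5)
         ∷ (# 5 , # 6) ∷ (# 6 , # 7) ∷ (# 7 , # 0)
         ∷ (# 7 , # 1) ∷ (# 7 , # 5) ∷ []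

kC82 : ℕ → Graph
kC82 k = record
  { n = k * 8
  ; m = k * 10
  ; ends = λ e →
      let (i , j) = remQuot {k} 10 e
          (a , b) = lookup C82edges j
      in (combine i a , combine i b)
  }

-- Lower bound: u₈u₁u₂ is a triangle, so a local antimagic labelling gives its three vertices
-- three different sums.
-- Upper bound: in copy i let r = i and t = k − 1 − i. The labels 1 … 8k are cut into eight
-- blocks of k consecutive labels, and each cycle edge of copy i gets the label at offset r or t
-- of its own block; the 2k largest labels go to u₈u₂ (offset 2t + 1) and u₈u₆ (offset 2r).
-- Every vertex then meets r and t equally often, so, as r + t = k − 1, its sum does not depend
-- on i: the sums are 8k+1, 13k+2, 14k+1, 27k+2, and these properly colour C(8,2).

{-# OPTIONS --safe #-}
module Submission where

open import Defs
open import Data.Bool using (T)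
open import Data.Nat using (ℕ; zero; suc; _+_; _*_; _≤_; _<_; _≤ᵇ_; _<ᵇ_; NonZero)
open import Data.Nat.Properties
  using (_≟_; +-identityʳ; +-assoc; m+[n∸m]≡n; <⇒≢; >⇒≢; <ᵇ⇒<; ≤ᵇ⇒≤; +-mono-<-≤;
         *-monoˡ-<; +-0-commutativeMonoid)
open import Data.Nat.ListAction using (sum)
open import Data.Nat.Tactic.RingSolver using (solve)
open import Data.Fin
  using (Fin; zero; suc; toℕ; punchIn; combine; remQuot; opposite; cast; _↑ˡ_; _↑ʳ_)
open import Data.Fin.Patterns using (0F; 1F; 2F; 3F; 4F; 5F; 6F; 7F; 8F; 9F)
open import Data.Fin.Properties
  using (injective⇒≤; remQuot-combine; combine-injective; combine-surjective; punchInᵢ≢i;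
         toℕ<n; opposite-prop; opposite-involutive; cast-involutive; toℕ-cast; toℕ-combine;
         toℕ-↑ˡ; toℕ-↑ʳ; *↔×; +↔⊎)
  renaming (_≟_ to _≟ᶠ_)
open import Data.List using (List; []; _∷_; map; allFin; tabulate; length; deduplicate; lookup)
open import Data.List.Properties using (map-tabulate; map-cong)
open import Data.List.Membership.Propositional using (_∈_)
open import Data.List.Membership.Propositional.Properties
  using (∈-map⁺; ∈-map⁻; ∈-allFin; ∈-lookup; ∈-deduplicate⁺; ∈-deduplicate⁻)
open import Data.List.Relation.Binary.Subset.Propositional using (_⊆_)
-- The constructors of All and AllPairs are opened only locally: overloading [] and _∷_ at top
-- level makes the variable lists passed to the ring solver ambiguous.
import Data.List.Relation.Unary.All as All
import Data.List.Relation.Unary.AllPairs as AllPairs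
open import Data.List.Relation.Unary.Any using (here; there; index)
open import Data.List.Relation.Unary.Any.Properties using (lookup-index)
open import Data.List.Relation.Unary.Unique.Propositional using (Unique)
open import Data.List.Relation.Unary.Unique.DecPropositional.Properties using (deduplicate-!)
open import Data.Product as Product using (_×_; _,_; proj₁; proj₂; ∃)
open import Data.Sum as Sum using (_⊎_; inj₁; inj₂; [_,_])
open import Data.Sum.Function.Propositional using (_⊎-↔_)
import Data.Vec as Vec
open import Function using (_∘_; _∋_; Injective)
open import Function.Bundles using (_⇔_; mk⇔; Equivalence; _↔_; mk↔ₛ′; Inverse; Bijection)
open import Function.Properties.Inverse using (↔-trans; ↔-sym; ↔⇒⤖)
open import Function.Related.Propositional using (module EquationalReasoning)
open import Relation.Binary.PropositionalEquality
  using (_≡_; _≢_; refl; sym; trans; cong; subst; module ≡-Reasoning)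
open import Relation.Nullary using (¬_; Dec; yes; no; contradiction)
open import Relation.Nullary.Decidable using (_⊎-dec_)

open import Algebra.Properties.CommutativeMonoid.Sum +-0-commutativeMonoid
  using (sum-syntax; sum-cong-≗; sum-remove; sum-replicate-zero)
  renaming (sum to ∑)

sum-tabulate : ∀ {n} (g : Fin n → ℕ) → sum (tabulate g) ≡ ∑ g
sum-tabulate {zero}  g = refl
sum-tabulate {suc n} g = cong (g zero +_) (sum-tabulate (g ∘ suc))

sum-map-allFin : ∀ {n} (g : Fin n → ℕ) → sum (map g (allFin n)) ≡ ∑ g
sum-map-allFin g = trans (cong sum (map-tabulate (λ i → i) g)) (sum-tabulate g)

∑-↑ : ∀ m {n} (g : Fin (m + n) → ℕ) → ∑ g ≡ ∑ (g ∘ (_↑ˡ n)) + ∑ (g ∘ (m ↑ʳ_))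
∑-↑ zero    g = refl
∑-↑ (suc m) g = trans (cong (g zero +_) (∑-↑ m (g ∘ suc))) (sym (+-assoc (g zero) _ _))

∑-combine : ∀ k {m} (g : Fin (k * m) → ℕ) → ∑ g ≡ ∑[ i < k ] ∑[ j < m ] g (combine i j)
∑-combine zero        g = refl
∑-combine (suc k) {m} g =
  trans (∑-↑ m g) (cong (∑ (g ∘ (_↑ˡ (k * m))) +_) (∑-combine k (g ∘ (m ↑ʳ_))))

∑-zero : ∀ {n} {g : Fin n → ℕ} → (∀ i → g i ≡ 0) → ∑ g ≡ 0
∑-zero {n} g≗0 = trans (sum-cong-≗ g≗0) (sum-replicate-zero n)

∑-single : ∀ {k} (i : Fin k) (g : Fin k → ℕ) →
           (∀ i′ → i′ ≢ i → g i′ ≡ 0) → ∑ g ≡ g i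
∑-single {suc k} i g vanishes = begin
  ∑ g                      ≡⟨ sum-remove g ⟩
  g i + ∑ (g ∘ punchIn i)  ≡⟨ cong (g i +_) (∑-zero (vanishes _ ∘ punchInᵢ≢i i)) ⟩
  g i + 0                  ≡⟨ +-identityʳ (g i) ⟩
  g i                      ∎
  where open ≡-Reasoning

Unique⇒lookup-injective : ∀ {xs : List ℕ} → Unique xs → Injective _≡_ _≡_ (lookup xs)
Unique⇒lookup-injective {_ ∷ _} _ {zero} {zero} _ = refl
Unique⇒lookup-injective {_ ∷ _} unique {zero} {suc j} eq =
  contradiction eq (All.lookup (AllPairs.head unique) (∈-lookup j))
Unique⇒lookup-injective {_ ∷ _} unique {suc i} {zero} eq =
  contradiction (sym eq) (All.lookup (AllPairs.head unique) (∈-lookup i))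
Unique⇒lookup-injective {_ ∷ _} unique {suc i} {suc j} eq =
  cong suc (Unique⇒lookup-injective (AllPairs.tail unique) eq)

Unique⇒length≤ : ∀ {xs ys : List ℕ} → Unique xs → xs ⊆ ys → length xs ≤ length ys
Unique⇒length≤ {xs} {ys} unique xs⊆ys = injective⇒≤ position-injective
  where
  position : Fin (length xs) → Fin (length ys)
  position i = index (xs⊆ys (∈-lookup i))

  position-injective : Injective _≡_ _≡_ position
  position-injective {i} {j} eq = Unique⇒lookup-injective unique (begin
    lookup xs i             ≡⟨ lookup-index (xs⊆ys (∈-lookup i)) ⟩
    lookup ys (position i)  ≡⟨ cong (lookup ys) eq ⟩
    lookup ys (position j)  ≡⟨ lookup-index (xs⊆ys (∈-lookup j)) ⟨
    lookup xs j             ∎)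
    where open ≡-Reasoning

module _ (G : Graph) (f : Labeling G) where

  values : List ℕ
  values = deduplicate _≟_ (map (vsum G f) (allFin (n G)))

  vsum∈values : ∀ v → vsum G f v ∈ values
  vsum∈values v = ∈-deduplicate⁺ _≟_ (∈-map⁺ (vsum G f) (∈-allFin v))

  numValues≤ : ∀ {W} → (∀ v → vsum G f v ∈ W) → numValues G f ≤ length W
  numValues≤ {W} vsum∈W = Unique⇒length≤ (deduplicate-! _≟_ _) values⊆W
    where
    values⊆W : values ⊆ W
    values⊆W x∈values with ∈-map⁻ (vsum G f) (∈-deduplicate⁻ _≟_ _ x∈values)
    ... | v , _ , refl = vsum∈W v

Adjacent : (G : Graph) → Fin (n G) → Fin (n G) → Set
Adjacent G u v = ∃ λ e → ends G e ≡ (u , v)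

Proper : (G : Graph) → (Fin (n G) → ℕ) → Set
Proper G c = ∀ e → c (proj₁ (ends G e)) ≢ c (proj₂ (ends G e))

Proper-Adjacent : ∀ {G c u v} → Proper G c → Adjacent G u v → c u ≢ c v
Proper-Adjacent proper (e , refl) = proper e

triangle⇒3≤χla : ∀ {G x y z} →
                 Adjacent G x y → Adjacent G y z → Adjacent G x z → ≤χla 3 G
triangle⇒3≤χla {G} {x} {y} {z} xy yz xz f antimagic = Unique⇒length≤ distinct attained
  where
  open All using ([]; _∷_)
  open AllPairs using ([]; _∷_)

  distinct : Unique (vsum G f x ∷ vsum G f y ∷ vsum G f z ∷ [])
  distinct = (Proper-Adjacent antimagic xy ∷ Proper-Adjacent antimagic xz ∷ [])
           ∷ (Proper-Adjacent antimagic yz ∷ []) ∷ [] ∷ []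

  attained : (vsum G f x ∷ vsum G f y ∷ vsum G f z ∷ []) ⊆ values G f
  attained = All.lookup (vsum∈values G f x ∷ vsum∈values G f y ∷ vsum∈values G f z ∷ [])

-- Generalises vsum to arbitrary edge weights: vsum G f is definitionally incidentSum G (label G f).
incidentSum : (G : Graph) → (Fin (m G) → ℕ) → Fin (n G) → ℕ
incidentSum G w v = sum (map (λ e → incid G v e (w e)) (allFin (m G)))

incidentSum-cong : ∀ G {w w′ : Fin (m G) → ℕ} → (∀ e → w e ≡ w′ e) →
                   ∀ v → incidentSum G w v ≡ incidentSum G w′ v
incidentSum-cong G w≗w′ v = cong sum (map-cong (cong (incid G v _) ∘ w≗w′) (allFin (m G)))

Touches : ∀ {n} → Fin n → Fin n × Fin n → Set
Touches v (x , y) = x ≡ v ⊎ y ≡ v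

touches? : ∀ {n} (v : Fin n) p → Dec (Touches v p)
touches? v (x , y) = (x ≟ᶠ v) ⊎-dec (y ≟ᶠ v)

incid-touching : ∀ G {v e} x → Touches v (ends G e) → incid G v e x ≡ x
incid-touching G {v} {e} x touching with proj₁ (ends G e) ≟ᶠ v | proj₂ (ends G e) ≟ᶠ v
... | yes _ | _     = refl
... | no _  | yes _ = refl
... | no p  | no q  = contradiction touching [ p , q ]

incid-nontouching : ∀ G {v e} x → ¬ Touches v (ends G e) → incid G v e x ≡ 0
incid-nontouching G {v} {e} x nontouching with proj₁ (ends G e) ≟ᶠ v | proj₂ (ends G e) ≟ᶠ v
... | yes p | _     = contradiction (inj₁ p) nontouching
... | no _  | yes q = contradiction (inj₂ q) nontouching
... | no _  | no _  = refl

incid-cong : ∀ G H {v w e d} x → (Touches v (ends G e) ⇔ Touches w (ends H d)) →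
             incid G v e x ≡ incid H w d x
incid-cong G H {w = w} {d = d} x touches⇔ with touches? w (ends H d)
... | yes touching =
  trans (incid-touching G x (Equivalence.from touches⇔ touching))
        (sym (incid-touching H x touching))
... | no nontouching =
  trans (incid-nontouching G x (nontouching ∘ Equivalence.to touches⇔))
        (sym (incid-nontouching H x nontouching))

copies : ℕ → Graph → Graph
copies k H = record
  { n    = k * n H
  ; m    = k * m H
  ; ends = λ e → let (i , j) = remQuot {k} (m H) e in Product.map (combine i) (combine i) (ends H j)
  }

-- kC82 k is definitionally copies k C82, so the lemmas about copies apply to it directly.
C82 : Graph
C82 = record { n = 8 ; m = 10 ; ends = Vec.lookup C82edges }

module _ {k : ℕ} {H : Graph} where

  inCopy : Fin k → Fin (n H) × Fin (n H) → Fin (k * n H) × Fin (k * n H)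
  inCopy i = Product.map (combine i) (combine i)

  ends-copies : ∀ i j → ends (copies k H) (combine i j) ≡ inCopy i (ends H j)
  ends-copies i j = cong (λ (i , j) → inCopy i (ends H j)) (remQuot-combine i j)

  Adjacent-copies : ∀ i {a b} → Adjacent H a b → Adjacent (copies k H) (combine i a) (combine i b)
  Adjacent-copies i (j , ab) = combine i j , trans (ends-copies i j) (cong (inCopy i) ab)

  Touches-inCopy⁺ : ∀ i {a p} → Touches a p → Touches (combine i a) (inCopy i p)
  Touches-inCopy⁺ i = Sum.map (cong (combine i)) (cong (combine i))

  Touches-inCopy⁻ : ∀ {i i′ a p} → Touches (combine i a) (inCopy i′ p) →
                    i′ ≡ i × Touches a p
  Touches-inCopy⁻ (inj₁ eq) = Product.map₂ inj₁ (combine-injective _ _ _ _ eq)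
  Touches-inCopy⁻ (inj₂ eq) = Product.map₂ inj₂ (combine-injective _ _ _ _ eq)

  Touches-copies⁻ : ∀ {i i′ a j} → Touches (combine i a) (ends (copies k H) (combine i′ j)) →
                    i′ ≡ i × Touches a (ends H j)
  Touches-copies⁻ {i′ = i′} {j = j} = Touches-inCopy⁻ ∘ subst (Touches _) (ends-copies i′ j)

  incid-copies-same : ∀ i a j x → incid (copies k H) (combine i a) (combine i j) x ≡ incid H a j x
  incid-copies-same i a j x = incid-cong (copies k H) H x (mk⇔
    (proj₂ ∘ Touches-copies⁻)
    (subst (Touches _) (sym (ends-copies i j)) ∘ Touches-inCopy⁺ i))

  incid-copies-other : ∀ {i i′} a j x → i′ ≢ i →
                       incid (copies k H) (combine i a) (combine i′ j) x ≡ 0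
  incid-copies-other a j x i′≢i =
    incid-nontouching (copies k H) x (i′≢i ∘ proj₁ ∘ Touches-copies⁻)

  incidentSum-copies : ∀ (w : Fin (k * m H) → ℕ) i a →
                       incidentSum (copies k H) w (combine i a) ≡ incidentSum H (w ∘ combine i) a
  incidentSum-copies w i a = begin
    incidentSum (copies k H) w (combine i a)
      ≡⟨ sum-map-allFin (λ e → incid (copies k H) (combine i a) e (w e)) ⟩
    ∑ (λ e → incid (copies k H) (combine i a) e (w e))
      ≡⟨ ∑-combine k _ ⟩
    ∑[ i′ < k ] ∑[ j < m H ] incid (copies k H) (combine i a) (combine i′ j) (w (combine i′ j))
      ≡⟨ ∑-single i _ (λ i′ i′≢i → ∑-zero (λ j → incid-copies-other a j _ i′≢i)) ⟩
    ∑[ j < m H ] incid (copies k H) (combine i a) (combine i j) (w (combine i j))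
      ≡⟨ sum-cong-≗ (λ j → incid-copies-same i a j _) ⟩
    ∑[ j < m H ] incid H a j (w (combine i j))
      ≡⟨ sum-map-allFin (λ j → incid H a j (w (combine i j))) ⟨
    incidentSum H (w ∘ combine i) a ∎
    where open ≡-Reasoning

  module _ {c : Fin (n H) → ℕ} {s : Fin (k * n H) → ℕ}
           (s≡c : ∀ (i : Fin k) a → s (combine i a) ≡ c a) where

    Proper-copies : Proper H c → Proper (copies k H) s
    Proper-copies proper e with combine-surjective {k} {m H} e
    ... | i , j , refl = subst (λ (u , v) → s u ≢ s v) (sym (ends-copies i j)) (proper j ∘ same-sum)
      where
      same-sum : s (combine i (proj₁ (ends H j))) ≡ s (combine i (proj₂ (ends H j))) →
                 c (proj₁ (ends H j)) ≡ c (proj₂ (ends H j))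
      same-sum eq = trans (sym (s≡c i _)) (trans eq (s≡c i _))

    ∈-copies : ∀ {W} → (∀ a → c a ∈ W) → ∀ v → s v ∈ W
    ∈-copies {W} c∈W v with combine-surjective {k} {n H} v
    ... | i , a , refl = subst (_∈ W) (sym (s≡c i a)) (c∈W a)

vertexSum : ℕ → Fin 8 → ℕ
vertexSum k 0F = 8 * k + 1
vertexSum k 1F = 13 * k + 2
vertexSum k 2F = 8 * k + 1
vertexSum k 3F = 14 * k + 1
vertexSum k 4F = 8 * k + 1
vertexSum k 5F = 14 * k + 1
vertexSum k 6F = 8 * k + 1
vertexSum k 7F = 27 * k + 2

vertexSums : ℕ → List ℕ
vertexSums k = 8 * k + 1 ∷ 13 * k + 2 ∷ 14 * k + 1 ∷ 27 * k + 2 ∷ []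

vertexSum∈vertexSums : ∀ k a → vertexSum k a ∈ vertexSums k
vertexSum∈vertexSums k 0F = here refl
vertexSum∈vertexSums k 1F = there (here refl)
vertexSum∈vertexSums k 2F = here refl
vertexSum∈vertexSums k 3F = there (there (here refl))
vertexSum∈vertexSums k 4F = here refl
vertexSum∈vertexSums k 5F = there (there (here refl))
vertexSum∈vertexSums k 6F = here refl
vertexSum∈vertexSums k 7F = there (there (there (here refl)))

affine-< : ∀ a b c d k .{{_ : NonZero k}} → T (a <ᵇ c) → T (b ≤ᵇ d) → a * k + b < c * k + d
affine-< a b c d k a<c b≤d = +-mono-<-≤ (*-monoˡ-< k (<ᵇ⇒< a c a<c)) (≤ᵇ⇒≤ b d b≤d)

vertexSum-proper : ∀ k .{{_ : NonZero k}} → Proper C82 (vertexSum k)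
vertexSum-proper k 0F = <⇒≢ (affine-<  8 1 13 2 k _ _)
vertexSum-proper k 1F = >⇒≢ (affine-<  8 1 13 2 k _ _)
vertexSum-proper k 2F = <⇒≢ (affine-<  8 1 14 1 k _ _)
vertexSum-proper k 3F = >⇒≢ (affine-<  8 1 14 1 k _ _)
vertexSum-proper k 4F = <⇒≢ (affine-<  8 1 14 1 k _ _)
vertexSum-proper k 5F = >⇒≢ (affine-<  8 1 14 1 k _ _)
vertexSum-proper k 6F = <⇒≢ (affine-<  8 1 27 2 k _ _)
vertexSum-proper k 7F = >⇒≢ (affine-<  8 1 27 2 k _ _)
vertexSum-proper k 8F = >⇒≢ (affine-< 13 2 27 2 k _ _)
vertexSum-proper k 9F = >⇒≢ (affine-< 14 1 27 2 k _ _)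

-- Positions of the labels 0 … 10k − 1 (label = 1 + position): the first 8k form eight blocks,
-- (c , p) ↦ k c + p; the last 2k are interleaved, (p , b) ↦ 8k + 2p + b.
Slot : Set → Set
Slot A = (Fin 8 × A) ⊎ (A × Fin 2)

mapSlot : ∀ {A B : Set} → (A → B) → Slot A → Slot B
mapSlot f = Sum.map (Product.map₂ f) (Product.map₁ f)

slot : ∀ {A : Set} → A → A → Fin 10 → Slot A
slot r t 0F = inj₁ (2F , r)
slot r t 1F = inj₁ (1F , r)
slot r t 2F = inj₁ (6F , t)
slot r t 3F = inj₁ (7F , r)
slot r t 4F = inj₁ (0F , t)
slot r t 5F = inj₁ (4F , t)
slot r t 6F = inj₁ (3F , r)
slot r t 7F = inj₁ (5F , t)
slot r t 8F = inj₂ (t , 1F)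
slot r t 9F = inj₂ (r , 0F)

slot-natural : ∀ {A B : Set} (f : A → B) r t j → mapSlot f (slot r t j) ≡ slot (f r) (f t) j
slot-natural f r t 0F = refl
slot-natural f r t 1F = refl
slot-natural f r t 2F = refl
slot-natural f r t 3F = refl
slot-natural f r t 4F = refl
slot-natural f r t 5F = refl
slot-natural f r t 6F = refl
slot-natural f r t 7F = refl
slot-natural f r t 8F = refl
slot-natural f r t 9F = refl

slotValue : ℕ → Slot ℕ → ℕ
slotValue k (inj₁ (c , p)) = k * toℕ c + p
slotValue k (inj₂ (p , b)) = 8 * k + (2 * p + toℕ b)

-- Each left-hand side is the sum of the labels at the vertex, in the shape incidentSum unfolds to.
C82-incidentSum-slot : ∀ {k} r t → suc (r + t) ≡ k →
                       ∀ a → incidentSum C82 (λ j → suc (slotValue k (slot r t j))) a ≡ vertexSum k a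
C82-incidentSum-slot r t refl 0F = let k = suc (r + t) in
  suc (k * 2 + r) + (suc (k * 5 + t) + 0) ≡ 8 * k + 1
    ∋ solve (r ∷ t ∷ [])
C82-incidentSum-slot r t refl 1F = let k = suc (r + t) in
  suc (k * 2 + r) + (suc (k * 1 + r) + (suc (8 * k + (2 * t + 1)) + 0)) ≡ 13 * k + 2
    ∋ solve (r ∷ t ∷ [])
C82-incidentSum-slot r t refl 2F = let k = suc (r + t) in
  suc (k * 1 + r) + (suc (k * 6 + t) + 0) ≡ 8 * k + 1
    ∋ solve (r ∷ t ∷ [])
C82-incidentSum-slot r t refl 3F = let k = suc (r + t) in
  suc (k * 6 + t) + (suc (k * 7 + r) + 0) ≡ 14 * k + 1
    ∋ solve (r ∷ t ∷ [])
C82-incidentSum-slot r t refl 4F = let k = suc (r + t) in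
  suc (k * 7 + r) + (suc (k * 0 + t) + 0) ≡ 8 * k + 1
    ∋ solve (r ∷ t ∷ [])
C82-incidentSum-slot r t refl 5F = let k = suc (r + t) in
  suc (k * 0 + t) + (suc (k * 4 + t) + (suc (8 * k + (2 * r + 0)) + 0)) ≡ 14 * k + 1
    ∋ solve (r ∷ t ∷ [])
C82-incidentSum-slot r t refl 6F = let k = suc (r + t) in
  suc (k * 4 + t) + (suc (k * 3 + r) + 0) ≡ 8 * k + 1
    ∋ solve (r ∷ t ∷ [])
C82-incidentSum-slot r t refl 7F = let k = suc (r + t) in
  suc (k * 3 + r) + (suc (k * 5 + t) + (suc (8 * k + (2 * t + 1)) + (suc (8 * k + (2 * r + 0)) + 0)))
    ≡ 27 * k + 2
    ∋ solve (r ∷ t ∷ [])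

suc-toℕ+toℕ-opposite : ∀ {n} (i : Fin n) → suc (toℕ i + toℕ (opposite i)) ≡ n
suc-toℕ+toℕ-opposite i =
  trans (cong (λ t → suc (toℕ i + t)) (opposite-prop i)) (m+[n∸m]≡n (toℕ<n i))

cast↔ : ∀ {m n} → m ≡ n → Fin m ↔ Fin n
cast↔ eq = mk↔ₛ′ (cast eq) (cast (sym eq)) (cast-involutive eq (sym eq)) (cast-involutive (sym eq) eq)

module Labelling (k : ℕ) where

  edgeSlot : Fin k × Fin 10 → Slot (Fin k)
  edgeSlot (i , j) = slot i (opposite i) j

  unslot : Slot (Fin k) → Fin k × Fin 10
  unslot (inj₁ (2F , p)) = p , 0F
  unslot (inj₁ (1F , p)) = p , 1F
  unslot (inj₁ (6F , p)) = opposite p , 2F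
  unslot (inj₁ (7F , p)) = p , 3F
  unslot (inj₁ (0F , p)) = opposite p , 4F
  unslot (inj₁ (4F , p)) = opposite p , 5F
  unslot (inj₁ (3F , p)) = p , 6F
  unslot (inj₁ (5F , p)) = opposite p , 7F
  unslot (inj₂ (p , 1F)) = opposite p , 8F
  unslot (inj₂ (p , 0F)) = p , 9F

  edgeSlot-unslot : ∀ s → edgeSlot (unslot s) ≡ s
  edgeSlot-unslot (inj₁ (2F , p)) = refl
  edgeSlot-unslot (inj₁ (1F , p)) = refl
  edgeSlot-unslot (inj₁ (6F , p)) = cong (λ q → inj₁ (6F , q)) (opposite-involutive p)
  edgeSlot-unslot (inj₁ (7F , p)) = refl
  edgeSlot-unslot (inj₁ (0F , p)) = cong (λ q → inj₁ (0F , q)) (opposite-involutive p)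
  edgeSlot-unslot (inj₁ (4F , p)) = cong (λ q → inj₁ (4F , q)) (opposite-involutive p)
  edgeSlot-unslot (inj₁ (3F , p)) = refl
  edgeSlot-unslot (inj₁ (5F , p)) = cong (λ q → inj₁ (5F , q)) (opposite-involutive p)
  edgeSlot-unslot (inj₂ (p , 1F)) = cong (λ q → inj₂ (q , 1F)) (opposite-involutive p)
  edgeSlot-unslot (inj₂ (p , 0F)) = refl

  unslot-edgeSlot : ∀ e → unslot (edgeSlot e) ≡ e
  unslot-edgeSlot (i , 0F) = refl
  unslot-edgeSlot (i , 1F) = refl
  unslot-edgeSlot (i , 2F) = cong (_, 2F) (opposite-involutive i)
  unslot-edgeSlot (i , 3F) = refl
  unslot-edgeSlot (i , 4F) = cong (_, 4F) (opposite-involutive i)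
  unslot-edgeSlot (i , 5F) = cong (_, 5F) (opposite-involutive i)
  unslot-edgeSlot (i , 6F) = refl
  unslot-edgeSlot (i , 7F) = cong (_, 7F) (opposite-involutive i)
  unslot-edgeSlot (i , 8F) = cong (_, 8F) (opposite-involutive i)
  unslot-edgeSlot (i , 9F) = refl

  slotIndex : Slot (Fin k) ↔ Fin (8 * k + k * 2)
  slotIndex = ↔-trans (↔-sym *↔× ⊎-↔ ↔-sym *↔×) (↔-sym +↔⊎)

  toℕ-slotIndex : ∀ s → toℕ (Inverse.to slotIndex s) ≡ slotValue k (mapSlot toℕ s)
  toℕ-slotIndex (inj₁ (c , p)) = trans (toℕ-↑ˡ (combine c p) (k * 2)) (toℕ-combine c p)
  toℕ-slotIndex (inj₂ (p , b)) =
    trans (toℕ-↑ʳ (8 * k) (combine p b)) (cong (8 * k +_) (toℕ-combine p b))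

  labelIndex : Fin (k * 10) ↔ Fin (k * 10)
  labelIndex = begin
    Fin (k * 10)         ↔⟨ *↔× ⟩
    (Fin k × Fin 10)     ↔⟨ mk↔ₛ′ edgeSlot unslot edgeSlot-unslot unslot-edgeSlot ⟩
    Slot (Fin k)         ↔⟨ slotIndex ⟩
    Fin (8 * k + k * 2)  ↔⟨ cast↔ 8k+2k≡10k ⟩
    Fin (k * 10)         ∎
    where
    open EquationalReasoning
    8k+2k≡10k : 8 * k + k * 2 ≡ k * 10
    8k+2k≡10k = solve (k ∷ [])

  labelling : Labeling (kC82 k)
  labelling = ↔⇒⤖ labelIndex

  toℕ-labelling : ∀ i j → toℕ (Bijection.to labelling (combine i j))
                        ≡ slotValue k (slot (toℕ i) (toℕ (opposite i)) j)
  toℕ-labelling i j = begin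
    toℕ (Bijection.to labelling (combine i j))
      ≡⟨ toℕ-cast _ _ ⟩
    toℕ (Inverse.to slotIndex (edgeSlot (remQuot 10 (combine i j))))
      ≡⟨ cong (toℕ ∘ Inverse.to slotIndex ∘ edgeSlot) (remQuot-combine i j) ⟩
    toℕ (Inverse.to slotIndex (slot i (opposite i) j))
      ≡⟨ toℕ-slotIndex (slot i (opposite i) j) ⟩
    slotValue k (mapSlot toℕ (slot i (opposite i) j))
      ≡⟨ cong (slotValue k) (slot-natural toℕ i (opposite i) j) ⟩
    slotValue k (slot (toℕ i) (toℕ (opposite i)) j) ∎
    where open ≡-Reasoning

  vsum-labelling : ∀ i a → vsum (kC82 k) labelling (combine i a) ≡ vertexSum k a
  vsum-labelling i a = begin
    vsum (kC82 k) labelling (combine i a)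
      ≡⟨ incidentSum-copies {H = C82} (label (kC82 k) labelling) i a ⟩
    incidentSum C82 (label (kC82 k) labelling ∘ combine i) a
      ≡⟨ incidentSum-cong C82 (cong suc ∘ toℕ-labelling i) a ⟩
    incidentSum C82 (λ j → suc (slotValue k (slot (toℕ i) (toℕ (opposite i)) j))) a
      ≡⟨ C82-incidentSum-slot (toℕ i) (toℕ (opposite i)) (suc-toℕ+toℕ-opposite i) a ⟩
    vertexSum k a ∎
    where open ≡-Reasoning

  labelling-antimagic : .{{_ : NonZero k}} → IsLocalAntimagic (kC82 k) labelling
  labelling-antimagic =
    Proper-copies {H = C82} {s = vsum (kC82 k) labelling} vsum-labelling (vertexSum-proper k)

  labelling-values : ∀ v → vsum (kC82 k) labelling v ∈ vertexSums k
  labelling-values =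
    ∈-copies {H = C82} {s = vsum (kC82 k) labelling} vsum-labelling (vertexSum∈vertexSums k)

theorem4p4 : ∀ (k : ℕ) → 1 ≤ k → ≤χla 3 (kC82 k) × χla≤ (kC82 k) 4
theorem4p4 (suc k) _ = lower , upper
  where
  open Labelling (suc k)

  lower : ≤χla 3 (kC82 (suc k))
  lower = triangle⇒3≤χla (Adjacent-copies {H = C82} zero (7F , refl))
                         (Adjacent-copies {H = C82} zero (0F , refl))
                         (Adjacent-copies {H = C82} zero (8F , refl))

  upper : χla≤ (kC82 (suc k)) 4
  upper = labelling , labelling-antimagic , numValues≤ (kC82 (suc k)) labelling labelling-values
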